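{- If $\pi \in M_{2n,k}$ then $\text{Stab}(\pi)$ under the action $\phi'$ is cyclic. Moreover, if $D_\pi$ is periodic with period $p$, then $\text{Stab}(\pi)$ is generated by $(p,\pi(p) - \pi(0))$.
   Context: Permutations $\pi\in S_m$ are bijections $\mathbb Z_m\to\mathbb Z_m$, written $[\pi(1)\ \pi(2)\ \cdots\ \pi(m)]$, with entries represented by $1,\dots,m$ (so e.g. $\pi(0)=\pi(m)$). For a positive integer $k$ the pointers are $(k,k+1)$; each entry $x$ has left pointer $(x-1,x)$ and right pointer $(x,x+1)$, and the pointer word $W(\pi)$ lists $L(\pi(1))R(\pi(1))\cdots L(\pi(m))R(\pi(m))$ with $(0,1)$ and $(m,m+1)$ removed. Two distinct pointers $p,q$ form a valid pointer context if they appear in the order $p\ldots q\ldots p\ldots q$ or $q\ldots p\ldots q\ldots p$ in $W(\pi)$. With $\pi=[a_1\ \cdots\ a_m]$, set $X_m=(0\ 1\ \cdots\ m)$, $Y_\pi=(a_m\ a_{m-1}\ \cdots\ a_1\ 0)$ (cycle notation) and $C_\pi=Y_\pi\circ X_m$; the strategic pile $\text{SP}(\pi)$ is the set of numbers after $m$ and before $0$ in the cycle of $C_\pi$ containing $0$ and $m$ (empty if they lie in different cycles). A permutation in $S_{2n}$ has maximal strategic pile if $|\text{SP}(\pi)|=2n-1$; in that case $2n$ appears immediately to the left of $1$, and its contraction is the permutation in $S_{2n-1}$ obtained by deleting the entry $2n$ (with $1$ given left pointer $(2n-1,1)$ and $2n-1$ right pointer $(2n-1,1)$). $M_{2n,k}$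 is the set of contractions of permutations in $S_{2n}$ with maximal strategic pile and exactly $k$ valid pointer contexts. Define $\phi:\mathbb Z_{2n-1}\times\mathbb Z_{2n-1}\times S_{2n-1}\to S_{2n-1}$ by $\phi(a,b,\pi)(x)=\pi(x-a)+b$; its restriction $\phi'$ to $\mathbb Z_{2n-1}\times\mathbb Z_{2n-1}\times M_{2n,k}$ is a group action of $\mathbb Z_{2n-1}\times\mathbb Z_{2n-1}$ on $M_{2n,k}$, and $\text{Stab}(\pi)$ is the stabilizer of $\pi$ under it. The difference sequence of $\pi\in S_m$ is $D_\pi\in\mathbb Z_m^m$ with $D_\pi(k)=\pi(k+1)-\pi(k)$ for $1\le k<m$ and $D_\pi(m)=\pi(1)-\pi(m)$; $\pi$ has periodic difference sequence with period $p$ if $p$ is the smallest integer with $0<p<m$ such that $D_\pi(k+p)=D_\pi(k)$ for all $k$ (indices mod $m$). -}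

module Defs where

open import Data.Nat using (ℕ; zero; suc; _+_; _*_; _∸_; _≤_; _<_)
open import Data.Nat.Properties using (_≟_)
open import Data.Nat.DivMod using (_%_; m%n<n)
open import Data.Fin using (Fin; toℕ; fromℕ<)
open import Data.Fin.Permutation using (Permutation′; _⟨$⟩ʳ_; _⟨$⟩ˡ_)
open import Data.Bool using (Bool; true; false; if_then_else_)
open import Data.List using (List; []; _∷_; _++_; map; concatMap; upTo; filter; length)
open import Data.List.Relation.Binary.Sublist.DecPropositional _≟_ using (_⊆_; _⊆?_)
import Data.Maybe
open import Data.Maybe using (Maybe; just; nothing; fromMaybe)
open import Data.Product using (Σ; Σ-syntax; _×_; _,_; proj₁; proj₂; ∃-syntax)
open import Data.Sum using (_⊎_)
open import Relation.Nullary using (¬_; Dec; does; ¬?)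
open import Relation.Nullary.Decidable using (_⊎-dec_; _×-dec_)
open import Relation.Binary.PropositionalEquality using (_≡_)
open import Function.Bundles using (_⇔_)

-- Fin m is identified with Z_m by residues: position
-- j ∈ {1..m} is the residue j mod m (so position m is the residue 0,
-- matching π(0) = π(m)), and an entry value e ∈ {1..m} is the residue
-- e mod m (so the value m is the residue 0).

_⊕_ : ∀ {m} → Fin (suc m) → Fin (suc m) → Fin (suc m)
_⊕_ {m} i j = fromℕ< (m%n<n (toℕ i + toℕ j) (suc m))

_⊖_ : ∀ {m} → Fin (suc m) → Fin (suc m) → Fin (suc m)
_⊖_ {m} i j = fromℕ< (m%n<n (toℕ i + (suc m ∸ toℕ j)) (suc m))

_·_ : ∀ {m} → ℕ → Fin (suc m) → Fin (suc m)
_·_ {m} k i = fromℕ< (m%n<n (k * toℕ i) (suc m))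

res : ∀ {m} → ℕ → Fin (suc m)
res {m} x = fromℕ< (m%n<n x (suc m))

valOf : ∀ {m} → Fin (suc m) → ℕ
valOf {m} Fin.zero = suc m
valOf (Fin.suc r) = suc (toℕ r)

entry : ∀ {m} → Permutation′ m → ℕ → ℕ
entry {zero} _ _ = 0
entry {suc m} σ j = valOf (σ ⟨$⟩ʳ res j)

posOf : ∀ {m} → Permutation′ m → ℕ → ℕ
posOf {zero} _ _ = 0
posOf {suc m} σ x = valOf (σ ⟨$⟩ˡ res x)

seq : ∀ {m} → Permutation′ m → List ℕ
seq {m} σ = map (λ i → entry σ (suc i)) (upTo m)

_==_ : ℕ → ℕ → Bool
x == y = does (x ≟ y)

-- Pointer word.  The pointer (k, k+1) is encoded by the natural k.
-- Entry x has left pointer x-1 and right pointer x; the pointers 0 and m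
-- are removed.

pointerWord : ∀ {m} → Permutation′ m → List ℕ
pointerWord {m} σ = concatMap lr (seq σ)
  where
  lr : ℕ → List ℕ
  lr x = (if x == 1 then [] else (x ∸ 1) ∷ []) ++ (if x == m then [] else x ∷ [])

ValidContext : ∀ {m} → Permutation′ m → ℕ → ℕ → Set
ValidContext σ p q =
  ¬ (p ≡ q) × ((p ∷ q ∷ p ∷ q ∷ []) ⊆ pointerWord σ ⊎ (q ∷ p ∷ q ∷ p ∷ []) ⊆ pointerWord σ)

validContext? : ∀ {m} (σ : Permutation′ m) (pq : ℕ × ℕ) → Dec (ValidContext σ (proj₁ pq) (proj₂ pq))
validContext? σ (p , q) =
  (¬? (p ≟ q)) ×-dec
    (((p ∷ q ∷ p ∷ q ∷ []) ⊆? pointerWord σ) ⊎-dec ((q ∷ p ∷ q ∷ p ∷ []) ⊆? pointerWord σ))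

-- all unordered pairs {p, q} of pointers, listed as (p , q) with 1 ≤ p < q ≤ m-1
pointerPairs : ℕ → List (ℕ × ℕ)
pointerPairs m =
  concatMap (λ q → map (λ p → (suc p , suc q)) (upTo q)) (upTo (m ∸ 1))

numContexts : ∀ {m} → Permutation′ m → ℕ
numContexts {m} σ = length (filter (validContext? σ) (pointerPairs m))

-- Strategic pile.
-- X_m = (0 1 ... m) and Y_σ = (a_m a_(m-1) ... a_1 0) on {0,...,m},
-- C_σ = Y_σ ∘ X_m.

Xm : ℕ → ℕ → ℕ
Xm m x = if x == m then 0 else suc x

Yσ : ∀ {m} → Permutation′ m → ℕ → ℕ
Yσ {m} σ x =
  if x == 0 then entry σ m
  else (let i = posOf σ x in if i == 1 then 0 else entry σ (i ∸ 1))

Cσ : ∀ {m} → Permutation′ m → ℕ → ℕ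
Cσ {m} σ x = Yσ σ (Xm m x)

spFrom : ∀ {m} → Permutation′ m → ℕ → ℕ → Maybe (List ℕ)
spFrom σ zero x = nothing
spFrom {m} σ (suc fuel) x =
  if x == 0 then just []
  else if x == m then nothing
  else Data.Maybe.map (x ∷_) (spFrom σ fuel (Cσ σ x))

-- SP(σ): the numbers after m and before 0 in the cycle of C_σ through m
-- (empty if 0 and m lie in different cycles).  The fuel m + 2 exceeds
-- the size of {0..m}, so it never runs out.
SP : ∀ {m} → Permutation′ m → List ℕ
SP {m} σ = fromMaybe [] (spFrom σ (m + 2) (Cσ σ m))

-- M_{2n,k}.  We write n = suc n′ (n ≥ 1), so 2n - 1 = suc (2 * n′).

deleteEntry : ℕ → List ℕ → List ℕ
deleteEntry x = filter (λ y → ¬? (y ≟ x))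

InM : (n′ k : ℕ) → Permutation′ (suc (2 * n′)) → Set
InM n′ k π =
  Σ[ σ ∈ Permutation′ (2 * suc n′) ]
    (length (SP σ) ≡ 2 * suc n′ ∸ 1)
    × (numContexts σ ≡ k)
    × (seq π ≡ deleteEntry (2 * suc n′) (seq σ))

φ : ∀ {m} → Fin (suc m) → Fin (suc m) → Permutation′ (suc m) → Fin (suc m) → Fin (suc m)
φ a b π x = (π ⟨$⟩ʳ (x ⊖ a)) ⊕ b

InStab : ∀ {m} → Permutation′ (suc m) → Fin (suc m) × Fin (suc m) → Set
InStab π (a , b) = ∀ x → φ a b π x ≡ π ⟨$⟩ʳ x

StabGeneratedBy : ∀ {m} → Permutation′ (suc m) → Fin (suc m) × Fin (suc m) → Set
StabGeneratedBy π (g₁ , g₂) =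
  ∀ a b → InStab π (a , b) ⇔ (∃[ j ] (a ≡ j · g₁ × b ≡ j · g₂))

StabCyclic : ∀ {m} → Permutation′ (suc m) → Set
StabCyclic {m} π = Σ[ g ∈ Fin (suc m) × Fin (suc m) ] StabGeneratedBy π g

D : ∀ {m} → Permutation′ (suc m) → Fin (suc m) → Fin (suc m)
D π k = (π ⟨$⟩ʳ (k ⊕ res 1)) ⊖ (π ⟨$⟩ʳ k)

ShiftInvariant : ∀ {m} → Permutation′ (suc m) → ℕ → Set
ShiftInvariant π p = ∀ k → D π (k ⊕ res p) ≡ D π k

PeriodicWithPeriod : ∀ {m} → Permutation′ (suc m) → ℕ → Set
PeriodicWithPeriod {m} π p =
  0 < p × p < suc m × ShiftInvariant π p
  × (∀ q → 0 < q → q < suc m → ShiftInvariant π q → p ≤ q)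

-- If (a, b) stabilizes π then π(y + a) = π(y) + b, so
-- b = π(a) − π(0) is determined by a, and (a, π(a) − π(0)) stabilizes π
-- exactly when the difference sequence D_π is invariant under the shift by a.
-- Such shifts are closed under sums and differences, hence under reduction
-- modulo one another, so the least positive one d divides all the others and
-- (d, π(d) − π(0)) generates the stabilizer.  If D_π has period p, then p is
-- that least shift.
module Submission where

open import Defs
open import Data.Nat using (ℕ; suc; _*_)
open import Data.Product using (_×_; _,_)
open import Data.Fin.Permutation using (Permutation′; _⟨$⟩ʳ_)

open import Data.Nat as ℕ using (zero; _+_; _∸_; _<_; _≤_; z≤n; s≤s; NonZero)
open import Data.Nat.Properties as ℕₚ using ()
open import Data.Nat.DivMod
open import Data.Fin as Fin using (Fin; toℕ)
open import Data.Fin.Properties as Finₚ using (toℕ-injective; toℕ-fromℕ<; toℕ<n)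
open import Data.Product using (∃-syntax)
open import Data.Sum using (inj₁; inj₂)
open import Data.Empty using (⊥-elim)
open import Relation.Nullary using (¬_; yes; no)
open import Relation.Nullary.Decidable using (_×-dec_)
open import Relation.Unary using (Decidable)
open import Relation.Binary.PropositionalEquality
open import Function.Bundles using (mk⇔)

Minimal : (ℕ → Set) → ℕ → Set
Minimal P d = P d × (∀ q → q < d → ¬ P q)

module _ {P : ℕ → Set} (P? : Decidable P) where

  private
    search : ∀ k f → (∀ q → q < k → ¬ P q) → P (k + f) → ∃[ d ] Minimal P d
    search k f below Pk+f with P? k
    ... | yes Pk = k , Pk , below
    search k zero below Pk+f | no ¬Pk = ⊥-elim (¬Pk (subst P (ℕₚ.+-identityʳ k) Pk+f))
    search k (suc f) below Pk+f | no ¬Pk =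
      search (suc k) f below′ (subst P (ℕₚ.+-suc k f) Pk+f)
      where
      below′ : ∀ q → q < suc k → ¬ P q
      below′ q q<1+k with ℕₚ.m<1+n⇒m<n∨m≡n q<1+k
      ... | inj₁ q<k = below q q<k
      ... | inj₂ refl = ¬Pk

  least-witness : ∀ {n} → P n → ∃[ d ] Minimal P d
  least-witness = search 0 _ (λ _ ())

-- x ⊕ y, x ⊖ y and j · x are definitionally res (toℕ x + toℕ y),
-- res (toℕ x + (N ∸ toℕ y)) and res (j * toℕ x), so each law reduces to
-- moving res in and out of sums.
module ZMod (m : ℕ) where

  private
    N : ℕ
    N = suc m

  toℕ-res : ∀ A → toℕ (res {m} A) ≡ A % N
  toℕ-res A = toℕ-fromℕ< _

  res-toℕ : (x : Fin N) → res (toℕ x) ≡ x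
  res-toℕ x = toℕ-injective (trans (toℕ-res (toℕ x)) (m<n⇒m%n≡m (toℕ<n x)))

  res-+ : ∀ A B → res {m} (A + B) ≡ res A ⊕ res B
  res-+ A B = toℕ-injective (begin
    toℕ (res (A + B))                ≡⟨ toℕ-res (A + B) ⟩
    (A + B) % N                      ≡⟨ %-distribˡ-+ A B N ⟩
    (A % N + B % N) % N              ≡⟨ cong₂ (λ u v → (u + v) % N) (toℕ-res A) (toℕ-res B) ⟨
    (toℕ (res A) + toℕ (res B)) % N  ≡⟨ toℕ-res (toℕ (res A) + toℕ (res B)) ⟨
    toℕ (res A ⊕ res B)              ∎)
    where open ≡-Reasoning

  res-+N : ∀ A → res {m} (A + N) ≡ res A
  res-+N A = toℕ-injective (trans (toℕ-res (A + N)) (trans ([m+n]%n≡m%n A N) (sym (toℕ-res A))))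

  ⊕-res : ∀ (x : Fin N) B → x ⊕ res B ≡ res (toℕ x + B)
  ⊕-res x B = trans (cong (_⊕ res B) (sym (res-toℕ x))) (sym (res-+ (toℕ x) B))

  res-⊕ : ∀ A (y : Fin N) → res A ⊕ y ≡ res (A + toℕ y)
  res-⊕ A y = trans (cong (res A ⊕_) (sym (res-toℕ y))) (sym (res-+ A (toℕ y)))

  ⊕-comm : (x y : Fin N) → x ⊕ y ≡ y ⊕ x
  ⊕-comm x y = cong res (ℕₚ.+-comm (toℕ x) (toℕ y))

  ⊕-assoc : (x y z : Fin N) → (x ⊕ y) ⊕ z ≡ x ⊕ (y ⊕ z)
  ⊕-assoc x y z = begin
    res (toℕ x + toℕ y) ⊕ z          ≡⟨ res-⊕ (toℕ x + toℕ y) z ⟩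
    res (toℕ x + toℕ y + toℕ z)      ≡⟨ cong res (ℕₚ.+-assoc (toℕ x) (toℕ y) (toℕ z)) ⟩
    res (toℕ x + (toℕ y + toℕ z))    ≡⟨ ⊕-res x (toℕ y + toℕ z) ⟨
    x ⊕ (y ⊕ z)                      ∎
    where open ≡-Reasoning

  ⊕-identityˡ : (x : Fin N) → Fin.zero ⊕ x ≡ x
  ⊕-identityˡ = res-toℕ

  ⊕-identityʳ : (x : Fin N) → x ⊕ Fin.zero ≡ x
  ⊕-identityʳ x = trans (⊕-comm x Fin.zero) (⊕-identityˡ x)

  ⊖-⊕-cancel : (x y : Fin N) → (x ⊖ y) ⊕ y ≡ x
  ⊖-⊕-cancel x y = begin
    res (toℕ x + (N ∸ toℕ y)) ⊕ y        ≡⟨ res-⊕ (toℕ x + (N ∸ toℕ y)) y ⟩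
    res (toℕ x + (N ∸ toℕ y) + toℕ y)    ≡⟨ cong res (ℕₚ.+-assoc (toℕ x) (N ∸ toℕ y) (toℕ y)) ⟩
    res (toℕ x + ((N ∸ toℕ y) + toℕ y))  ≡⟨ cong (λ n → res (toℕ x + n)) (ℕₚ.m∸n+n≡m (ℕₚ.<⇒≤ (toℕ<n y))) ⟩
    res (toℕ x + N)                      ≡⟨ res-+N (toℕ x) ⟩
    res (toℕ x)                          ≡⟨ res-toℕ x ⟩
    x                                    ∎
    where open ≡-Reasoning

  ⊕-⊖-cancel : (x y : Fin N) → (x ⊕ y) ⊖ y ≡ x
  ⊕-⊖-cancel x y = begin
    (x ⊕ y) ⊖ y                          ≡⟨ ⊕-res (x ⊕ y) (N ∸ toℕ y) ⟨
    res (toℕ x + toℕ y) ⊕ res (N ∸ toℕ y) ≡⟨ res-+ (toℕ x + toℕ y) (N ∸ toℕ y) ⟨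
    res (toℕ x + toℕ y + (N ∸ toℕ y))    ≡⟨ cong res (ℕₚ.+-assoc (toℕ x) (toℕ y) (N ∸ toℕ y)) ⟩
    res (toℕ x + (toℕ y + (N ∸ toℕ y)))  ≡⟨ cong (λ n → res (toℕ x + n)) (ℕₚ.m+[n∸m]≡n (ℕₚ.<⇒≤ (toℕ<n y))) ⟩
    res (toℕ x + N)                      ≡⟨ res-+N (toℕ x) ⟩
    res (toℕ x)                          ≡⟨ res-toℕ x ⟩
    x                                    ∎
    where open ≡-Reasoning

  ⊕⇒≡⊖ : (x y : Fin N) {z : Fin N} → x ⊕ y ≡ z → x ≡ z ⊖ y
  ⊕⇒≡⊖ x y x⊕y≡z = trans (sym (⊕-⊖-cancel x y)) (cong (_⊖ y) x⊕y≡z)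

  ⊖-self : (x : Fin N) → x ⊖ x ≡ Fin.zero
  ⊖-self x = sym (⊕⇒≡⊖ Fin.zero x (⊕-identityˡ x))

  ⊖-identityʳ : (x : Fin N) → x ⊖ Fin.zero ≡ x
  ⊖-identityʳ x = sym (⊕⇒≡⊖ x Fin.zero (⊕-identityʳ x))

  ⊖-translate : (x y z : Fin N) → (x ⊕ z) ⊖ (y ⊕ z) ≡ x ⊖ y
  ⊖-translate x y z = sym (⊕⇒≡⊖ (x ⊖ y) (y ⊕ z) (begin
    (x ⊖ y) ⊕ (y ⊕ z)  ≡⟨ ⊕-assoc (x ⊖ y) y z ⟨
    ((x ⊖ y) ⊕ y) ⊕ z  ≡⟨ cong (_⊕ z) (⊖-⊕-cancel x y) ⟩
    x ⊕ z              ∎))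
    where open ≡-Reasoning

  ⊖-exchange : (x x′ y y′ : Fin N) → x′ ⊖ x ≡ y′ ⊖ y → x′ ⊖ y′ ≡ x ⊖ y
  ⊖-exchange x x′ y y′ e = sym (⊕⇒≡⊖ (x ⊖ y) y′ (begin
    (x ⊖ y) ⊕ y′                 ≡⟨ cong ((x ⊖ y) ⊕_) (⊖-⊕-cancel y′ y) ⟨
    (x ⊖ y) ⊕ ((y′ ⊖ y) ⊕ y)     ≡⟨ cong (λ w → (x ⊖ y) ⊕ (w ⊕ y)) e ⟨
    (x ⊖ y) ⊕ ((x′ ⊖ x) ⊕ y)     ≡⟨ cong ((x ⊖ y) ⊕_) (⊕-comm (x′ ⊖ x) y) ⟩
    (x ⊖ y) ⊕ (y ⊕ (x′ ⊖ x))     ≡⟨ ⊕-assoc (x ⊖ y) y (x′ ⊖ x) ⟨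
    ((x ⊖ y) ⊕ y) ⊕ (x′ ⊖ x)     ≡⟨ cong (_⊕ (x′ ⊖ x)) (⊖-⊕-cancel x y) ⟩
    x ⊕ (x′ ⊖ x)                 ≡⟨ ⊕-comm x (x′ ⊖ x) ⟩
    (x′ ⊖ x) ⊕ x                 ≡⟨ ⊖-⊕-cancel x′ x ⟩
    x′                           ∎))
    where open ≡-Reasoning

  ⊕-res-+ : ∀ (x : Fin N) A B → (x ⊕ res A) ⊕ res B ≡ x ⊕ res (A + B)
  ⊕-res-+ x A B = trans (⊕-assoc x (res A) (res B)) (cong (x ⊕_) (sym (res-+ A B)))

  xy⊕z≡xz⊕y : (x y z : Fin N) → (x ⊕ y) ⊕ z ≡ (x ⊕ z) ⊕ y
  xy⊕z≡xz⊕y x y z = begin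
    (x ⊕ y) ⊕ z  ≡⟨ ⊕-assoc x y z ⟩
    x ⊕ (y ⊕ z)  ≡⟨ cong (x ⊕_) (⊕-comm y z) ⟩
    x ⊕ (z ⊕ y)  ≡⟨ ⊕-assoc x z y ⟨
    (x ⊕ z) ⊕ y  ∎
    where open ≡-Reasoning

  ·-suc : ∀ j (x : Fin N) → suc j · x ≡ x ⊕ (j · x)
  ·-suc j x = sym (⊕-res x (j * toℕ x))

  res-* : ∀ j A → res {m} (j * A) ≡ j · res A
  res-* zero    A = refl
  res-* (suc j) A = begin
    res (A + j * A)        ≡⟨ res-+ A (j * A) ⟩
    res A ⊕ res (j * A)    ≡⟨ cong (res A ⊕_) (res-* j A) ⟩
    res A ⊕ (j · res A)    ≡⟨ ·-suc j (res A) ⟨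
    suc j · res A          ∎
    where open ≡-Reasoning

module Stabilizer {m : ℕ} (π : Permutation′ (suc m)) where

  open ZMod m

  private
    N : ℕ
    N = suc m

  σ : Fin N → Fin N
  σ x = π ⟨$⟩ʳ x

  generator : ℕ → Fin N × Fin N
  generator q = res q , σ (res q) ⊖ σ (res 0)

  Translates : Fin N × Fin N → Set
  Translates (a , b) = ∀ y → σ (y ⊕ a) ≡ σ y ⊕ b

  InStab⇒Translates : ∀ {a b} → InStab π (a , b) → Translates (a , b)
  InStab⇒Translates {a} {b} s y =
    trans (sym (s (y ⊕ a))) (cong (λ x → σ x ⊕ b) (⊕-⊖-cancel y a))

  Translates⇒InStab : ∀ {a b} → Translates (a , b) → InStab π (a , b)
  Translates⇒InStab {a} {b} t x =
    trans (sym (t (x ⊖ a))) (cong σ (⊖-⊕-cancel x a))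

  InStab-offset : ∀ {a b} → InStab π (a , b) → b ≡ σ a ⊖ σ Fin.zero
  InStab-offset {a} {b} s = ⊕⇒≡⊖ b (σ Fin.zero) (begin
    b ⊕ σ Fin.zero      ≡⟨ ⊕-comm b (σ Fin.zero) ⟩
    σ Fin.zero ⊕ b      ≡⟨ InStab⇒Translates {a} {b} s Fin.zero ⟨
    σ (Fin.zero ⊕ a)    ≡⟨ cong σ (⊕-identityˡ a) ⟩
    σ a                 ∎)
    where open ≡-Reasoning

  InStab-zero : InStab π (Fin.zero , Fin.zero)
  InStab-zero = Translates⇒InStab λ y →
    trans (cong σ (⊕-identityʳ y)) (sym (⊕-identityʳ (σ y)))

  InStab-⊕ : ∀ {a b a′ b′} → InStab π (a , b) → InStab π (a′ , b′) →
             InStab π (a ⊕ a′ , b ⊕ b′)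
  InStab-⊕ {a} {b} {a′} {b′} s s′ = Translates⇒InStab λ y → begin
    σ (y ⊕ (a ⊕ a′))   ≡⟨ cong σ (⊕-assoc y a a′) ⟨
    σ ((y ⊕ a) ⊕ a′)   ≡⟨ InStab⇒Translates s′ (y ⊕ a) ⟩
    σ (y ⊕ a) ⊕ b′     ≡⟨ cong (_⊕ b′) (InStab⇒Translates s y) ⟩
    (σ y ⊕ b) ⊕ b′     ≡⟨ ⊕-assoc (σ y) b b′ ⟩
    σ y ⊕ (b ⊕ b′)     ∎
    where open ≡-Reasoning

  InStab-· : ∀ {a b} j → InStab π (a , b) → InStab π (j · a , j · b)
  InStab-· zero    s = InStab-zero
  InStab-· {a} {b} (suc j) s =
    subst₂ (λ u v → InStab π (u , v)) (sym (·-suc j a)) (sym (·-suc j b))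
      (InStab-⊕ {a} {b} {j · a} {j · b} s (InStab-· j s))

  InStab⇒ShiftInvariant : ∀ {a b} → InStab π (a , b) → ShiftInvariant π (toℕ a)
  InStab⇒ShiftInvariant {a} {b} s k = begin
    σ ((k ⊕ a′) ⊕ res 1) ⊖ σ (k ⊕ a′)  ≡⟨ cong (λ x → σ x ⊖ σ (k ⊕ a′)) (xy⊕z≡xz⊕y k a′ (res 1)) ⟩
    σ ((k ⊕ res 1) ⊕ a′) ⊖ σ (k ⊕ a′)  ≡⟨ cong₂ _⊖_ (translate (k ⊕ res 1)) (translate k) ⟩
    (σ (k ⊕ res 1) ⊕ b) ⊖ (σ k ⊕ b)    ≡⟨ ⊖-translate (σ (k ⊕ res 1)) (σ k) b ⟩
    σ (k ⊕ res 1) ⊖ σ k                ∎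
    where
    open ≡-Reasoning
    a′ = res (toℕ a)
    translate : ∀ y → σ (y ⊕ a′) ≡ σ y ⊕ b
    translate y = trans (cong (λ x → σ (y ⊕ x)) (res-toℕ a)) (InStab⇒Translates s y)

  ShiftInvariant⇒InStab : ∀ q → ShiftInvariant π q → InStab π (generator q)
  ShiftInvariant⇒InStab q si = Translates⇒InStab λ y → begin
    σ (y ⊕ a)                    ≡⟨ ⊖-⊕-cancel (σ (y ⊕ a)) (σ y) ⟨
    δ y ⊕ σ y                    ≡⟨ cong (λ z → δ z ⊕ σ y) (res-toℕ y) ⟨
    δ (res (toℕ y)) ⊕ σ y        ≡⟨ cong (_⊕ σ y) (δ-res (toℕ y)) ⟩
    δ Fin.zero ⊕ σ y             ≡⟨ cong (λ z → (σ z ⊖ σ Fin.zero) ⊕ σ y) (⊕-identityˡ a) ⟩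
    (σ a ⊖ σ Fin.zero) ⊕ σ y     ≡⟨ ⊕-comm (σ a ⊖ σ Fin.zero) (σ y) ⟩
    σ y ⊕ (σ a ⊖ σ Fin.zero)     ∎
    where
    open ≡-Reasoning
    a = res q
    δ : Fin N → Fin N
    δ z = σ (z ⊕ a) ⊖ σ z
    δ-step : ∀ z → δ (z ⊕ res 1) ≡ δ z
    δ-step z = ⊖-exchange (σ (z ⊕ a)) (σ ((z ⊕ res 1) ⊕ a)) (σ z) (σ (z ⊕ res 1))
      (trans (cong (λ x → σ x ⊖ σ (z ⊕ a)) (xy⊕z≡xz⊕y z (res 1) a)) (si z))
    δ-res : ∀ t → δ (res t) ≡ δ Fin.zero
    δ-res zero    = refl
    δ-res (suc t) = trans (cong δ (trans (res-+ 1 t) (⊕-comm (res 1) (res t))))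
                          (trans (δ-step (res t)) (δ-res t))

  ShiftInvariant-0 : ShiftInvariant π 0
  ShiftInvariant-0 k = cong (D π) (⊕-identityʳ k)

  ShiftInvariant-N : ShiftInvariant π N
  ShiftInvariant-N k = trans (cong (λ x → D π (k ⊕ x)) (res-+N 0)) (ShiftInvariant-0 k)

  ShiftInvariant-+ : ∀ A B → ShiftInvariant π A → ShiftInvariant π B →
                     ShiftInvariant π (A + B)
  ShiftInvariant-+ A B siA siB k = begin
    D π (k ⊕ res (A + B))        ≡⟨ cong (D π) (⊕-res-+ k A B) ⟨
    D π ((k ⊕ res A) ⊕ res B)    ≡⟨ siB (k ⊕ res A) ⟩
    D π (k ⊕ res A)              ≡⟨ siA k ⟩
    D π k                        ∎
    where open ≡-Reasoning

  ShiftInvariant-∸ : ∀ A B → B ≤ A → ShiftInvariant π A → ShiftInvariant π B →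
                     ShiftInvariant π (A ∸ B)
  ShiftInvariant-∸ A B B≤A siA siB k = begin
    D π (k ⊕ res (A ∸ B))              ≡⟨ siB (k ⊕ res (A ∸ B)) ⟨
    D π ((k ⊕ res (A ∸ B)) ⊕ res B)    ≡⟨ cong (D π) (⊕-res-+ k (A ∸ B) B) ⟩
    D π (k ⊕ res (A ∸ B + B))          ≡⟨ cong (λ n → D π (k ⊕ res n)) (ℕₚ.m∸n+n≡m B≤A) ⟩
    D π (k ⊕ res A)                    ≡⟨ siA k ⟩
    D π k                              ∎
    where open ≡-Reasoning

  ShiftInvariant-* : ∀ j d → ShiftInvariant π d → ShiftInvariant π (j * d)
  ShiftInvariant-* zero    d sid = ShiftInvariant-0
  ShiftInvariant-* (suc j) d sid = ShiftInvariant-+ d (j * d) sid (ShiftInvariant-* j d sid)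

  ShiftInvariant-% : ∀ A d .{{_ : NonZero d}} → ShiftInvariant π A → ShiftInvariant π d →
                     ShiftInvariant π (A % d)
  ShiftInvariant-% A d siA sid = subst (ShiftInvariant π) (sym (m%n≡m∸m/n*n A d))
    (ShiftInvariant-∸ A (A / d * d) (m/n*n≤m A d) siA (ShiftInvariant-* (A / d) d sid))

  Period : ℕ → Set
  Period q = 0 < q × ShiftInvariant π q

  period? : Decidable Period
  period? q = (0 ℕ.<? q) ×-dec Finₚ.all? (λ k → D π (k ⊕ res q) Finₚ.≟ D π k)

  leastPeriod-divides : ∀ {d A} .{{_ : NonZero d}} → Minimal Period d →
                        ShiftInvariant π A → A % d ≡ 0
  leastPeriod-divides {d} {A} ((_ , sid) , below) siA with A % d in eq
  ... | zero  = refl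
  ... | suc r = ⊥-elim (below (suc r) (subst (_< d) eq (m%n<n A d))
                  (s≤s z≤n , subst (ShiftInvariant π) eq (ShiftInvariant-% A d siA sid)))

  leastPeriod-generates : ∀ {d} → Minimal Period d → StabGeneratedBy π (generator d)
  leastPeriod-generates {d} least@((0<d , sid) , _) a b = mk⇔ InStab⇒multiple multiple⇒InStab
    where
    instance
      d≢0 : NonZero d
      d≢0 = ℕ.>-nonZero 0<d

    c : Fin N
    c = σ (res d) ⊖ σ (res 0)

    generator-InStab : InStab π (res d , c)
    generator-InStab = ShiftInvariant⇒InStab d sid

    multiple⇒InStab : ∃[ j ] (a ≡ j · res d × b ≡ j · c) → InStab π (a , b)
    multiple⇒InStab (j , refl , refl) = InStab-· j generator-InStab

    InStab⇒multiple : InStab π (a , b) → ∃[ j ] (a ≡ j · res d × b ≡ j · c)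
    InStab⇒multiple s = q , a≡ , b≡
      where
      open ≡-Reasoning
      q = toℕ a / d
      a≡ : a ≡ q · res d
      a≡ = begin
        a                           ≡⟨ res-toℕ a ⟨
        res (toℕ a)                 ≡⟨ cong res (m≡m%n+[m/n]*n (toℕ a) d) ⟩
        res (toℕ a % d + q * d)     ≡⟨ cong (λ r → res (r + q * d))
                                          (leastPeriod-divides least (InStab⇒ShiftInvariant {a} {b} s)) ⟩
        res (q * d)                 ≡⟨ res-* q d ⟩
        q · res d                   ∎
      b≡ : b ≡ q · c
      b≡ = begin
        b                           ≡⟨ InStab-offset {a} {b} s ⟩
        σ a ⊖ σ Fin.zero            ≡⟨ cong (λ x → σ x ⊖ σ Fin.zero) a≡ ⟩
        σ (q · res d) ⊖ σ Fin.zero  ≡⟨ InStab-offset {q · res d} {q · c} (InStab-· q generator-InStab) ⟨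
        q · c                       ∎

  periodic⇒leastPeriod : ∀ {p} → PeriodicWithPeriod π p → Minimal Period p
  periodic⇒leastPeriod (0<p , p<N , sip , least) =
    (0<p , sip) , λ q q<p (0<q , siq) → ℕₚ.<⇒≱ q<p (least q 0<q (ℕₚ.<-trans q<p p<N) siq)

  stabCyclic : StabCyclic π
  stabCyclic with least-witness period? {N} (s≤s z≤n , ShiftInvariant-N)
  ... | d , least = generator d , leastPeriod-generates least

theorem3p8 : (n′ k : ℕ) (π : Permutation′ (suc (2 * n′))) → InM n′ k π →
    StabCyclic π
    × ((p : ℕ) → PeriodicWithPeriod π p →
    StabGeneratedBy π (res p , ((π ⟨$⟩ʳ res p) ⊖ (π ⟨$⟩ʳ res 0))))
theorem3p8 _ _ π _ = stabCyclic , λ _ periodic → leastPeriod-generates (periodic⇒leastPeriod periodic)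
  where open Stabilizer π
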